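{- Let ${\tt f}$ be the Fibonacci word and let ${\tt w}=D({\tt f})$ be the Fibonacci word with its initial ${\tt a}{\tt b}$ deleted. Then $r_{\tt w}(n)=n+1$ for all $n\geqslant1$.
   Context: The Fibonacci word ${\tt f}={\tt a}{\tt b}{\tt a}{\tt a}{\tt b}{\tt a}{\tt b}{\tt a}\cdots$ is the fixed point of $\varrho_F:{\tt a}\mapsto{\tt a}{\tt b},\ {\tt b}\mapsto{\tt a}$. For a word in which both letters occur infinitely often, $D$ deletes the first occurrence of ${\tt a}$ and the first occurrence of ${\tt b}$. Words are indexed from position $0$; $p_{\tt a}(n)$, $p_{\tt b}(n)$ denote the positions of the $n$-th ${\tt a}$ and $n$-th ${\tt b}$, and $r_{\tt w}(n)=p_{\tt b}(n)-p_{\tt a}(n)$. -}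

module Defs where

open import Data.Nat using (ℕ; zero; suc; _+_; _<ᵇ_)
open import Data.Bool using (if_then_else_)
open import Data.List using (List; []; _∷_; concatMap)
open import Data.Product using (_×_)
open import Relation.Binary.PropositionalEquality using (_≡_)
open import Relation.Nullary using (does)

data Letter : Set where
  a b : Letter

_≟L_ : (x y : Letter) → Relation.Nullary.Dec (x ≡ y)
a ≟L a = Relation.Nullary.yes Relation.Binary.PropositionalEquality.refl
a ≟L b = Relation.Nullary.no (λ ())
b ≟L a = Relation.Nullary.no (λ ())
b ≟L b = Relation.Nullary.yes Relation.Binary.PropositionalEquality.refl

Word : Set
Word = ℕ → Letter

ρF : Letter → List Letter
ρF a = a ∷ b ∷ []
ρF b = a ∷ []

ρF* : List Letter → List Letter
ρF* = concatMap ρF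

iterρ : ℕ → List Letter
iterρ zero = a ∷ []
iterρ (suc k) = ρF* (iterρ k)

-- list lookup with a default (only used at indices that are in range)
nth : List Letter → ℕ → Letter
nth [] _ = a
nth (x ∷ xs) zero = x
nth (x ∷ xs) (suc i) = nth xs i

-- Fibonacci word: the fixed point of ρF, i.e. the limit of ρF^k(a);
-- ρF^(n+1)(a) has length F_{n+3} > n, and is a prefix of the fixed point.
fib : Word
fib n = nth (iterρ (suc n)) n

count : Letter → Word → ℕ → ℕ
count c x zero = 0
count c x (suc p) = if does (x p ≟L c) then suc (count c x p) else count c x p

-- position p is the n-th occurrence of c in x (occurrences counted from 1)
IsNth : Word → Letter → ℕ → ℕ → Set
IsNth x c n p = (x p ≡ c) × (suc (count c x p) ≡ n)

delete : ℕ → Word → Word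
delete p x i = if i <ᵇ p then x i else x (suc i)

-- D, given the positions pa, pb of the first a and first b of x:
-- delete the later of the two positions first, then the earlier one.
Dat : ℕ → ℕ → Word → Word
Dat pa pb x = if pa <ᵇ pb then delete pa (delete pb x) else delete pb (delete pa x)

-- Since f = ρF(f), the image ρF(f k) of the k-th letter of f occupies the positions
-- from imagePos k = k + |f[0,k)|ₐ on; it starts with a, and with ab when f k = a.
-- Every block ρF(f i) contains exactly one a, so f[0, imagePos k) has k letters a and
-- |f[0,k)|ₐ letters b.  Hence the (n+1)-th a of f is at imagePos n, and the (n+1)-th b,
-- the one in the block of that a, at imagePos (imagePos n) + 1 = imagePos n + n + 1.
-- As f starts with ab, D(f) is f shifted by two, and its n-th a and b are the
-- (n+1)-th ones of f.
module Submission where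

open import Defs
open import Data.Nat using (ℕ; zero; suc; _+_; _≥_; _≤_; _<_; _≤′_; ≤′-refl; ≤′-step; z≤n; s≤s)
open import Data.Nat.Properties
  using (suc-injective; +-suc; +-identityʳ; +-comm; +-cancelˡ-≡; ≤-refl; ≤-trans; ≤-reflexive;
         ≤-total; ≤⇒≤′; n≤1+n; m≤m+n; <-irrefl; <-cmp)
open import Data.Bool using (true; false)
open import Data.List using ([]; _∷_; _++_; length)
open import Data.List.Properties using (concatMap-++)
open import Data.Product using (Σ; ∃; _×_; _,_)
open import Data.Sum using (inj₁; inj₂)
open import Function using (case_of_; _∘′_)
open import Relation.Binary using (tri<; tri≈; tri>)
open import Relation.Nullary using (does; yes; no; contradiction)
open import Relation.Binary.PropositionalEquality
  using (_≡_; _≢_; refl; sym; trans; cong; subst; module ≡-Reasoning)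
open ≡-Reasoning

private
  variable
    c d : Letter
    x : Word
    k n p q : ℕ

count-hit : ∀ x p → x p ≡ c → count c x (suc p) ≡ suc (count c x p)
count-hit {c} x p e with x p ≟L c
... | yes _ = refl
... | no ne = contradiction e ne

count-miss : ∀ x p → x p ≡ d → d ≢ c → count c x (suc p) ≡ count c x p
count-miss {c = c} x p e d≢c with x p ≟L c
... | yes e′ = contradiction (trans (sym e) e′) d≢c
... | no _ = refl

count-mono : p ≤ q → count c x p ≤ count c x q
count-mono = go ∘′ ≤⇒≤′
  where
  go : p ≤′ q → count c x p ≤ count c x q
  go ≤′-refl = ≤-refl
  go {q = suc q} {c} {x} (≤′-step p≤q) with does (x q ≟L c)
  ... | true = ≤-trans (go p≤q) (n≤1+n _)
  ... | false = go p≤q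

count-< : x p ≡ c → p < q → count c x p < count c x q
count-< {x} {p} e p<q = ≤-trans (≤-reflexive (sym (count-hit x p e))) (count-mono p<q)

IsNth-unique : ∀ p q → IsNth x c n p → IsNth x c n q → p ≡ q
IsNth-unique p q (xp≡c , #p) (xq≡c , #q) with <-cmp p q
... | tri< p<q _ _ = contradiction (count-< xp≡c p<q) (<-irrefl (suc-injective (trans #p (sym #q))))
... | tri≈ _ p≡q _ = p≡q
... | tri> _ _ q<p = contradiction (count-< xq≡c q<p) (<-irrefl (suc-injective (trans #q (sym #p))))

count-a+count-b : ∀ x p → count a x p + count b x p ≡ p
count-a+count-b x zero = refl
count-a+count-b x (suc p) with x p
... | a = cong suc (count-a+count-b x p)
... | b = trans (+-suc _ _) (cong suc (count-a+count-b x p))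

count-+ : ∀ c x d p → count c x (d + p) ≡ count c x d + count c (λ i → x (d + i)) p
count-+ c x d zero = trans (cong (count c x) (+-identityʳ d)) (sym (+-identityʳ _))
count-+ c x d (suc p) rewrite +-suc d p with does (x (d + p) ≟L c)
... | true = trans (cong suc (count-+ c x d p)) (sym (+-suc _ _))
... | false = count-+ c x d p

count-ext : ∀ c {x y : Word} k → (∀ i → i < k → x i ≡ y i) → count c x k ≡ count c y k
count-ext c zero _ = refl
count-ext c (suc k) x≗y
  rewrite x≗y k ≤-refl | count-ext c k (λ i i<k → x≗y i (≤-trans i<k (n≤1+n k))) = refl

count₂-ab : ∀ x → x 0 ≡ a → x 1 ≡ b → ∀ c → count c x 2 ≡ 1
count₂-ab _ x0≡a x1≡b a rewrite x0≡a | x1≡b = refl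
count₂-ab _ x0≡a x1≡b b rewrite x0≡a | x1≡b = refl

-- Dat 0 1 x i reduces to x (2 + i).
IsNth-Dat01 : ∀ x p → x 0 ≡ a → x 1 ≡ b → IsNth x c (suc (suc n)) p →
              Σ ℕ λ i → p ≡ 2 + i × IsNth (Dat 0 1 x) c (suc n) i
IsNth-Dat01 _ zero _ _ (_ , ())
IsNth-Dat01 {c} x (suc zero) x0≡a x1≡b (x1≡c , #1) =
  case trans (sym (count₂-ab x x0≡a x1≡b c)) (trans (count-hit x 1 x1≡c) #1) of λ ()
IsNth-Dat01 {c} {n} x (suc (suc i)) x0≡a x1≡b (x2+i≡c , #2+i) = i , refl , x2+i≡c , (begin
  suc (count c (Dat 0 1 x) i)          ≡⟨ cong (_+ count c (Dat 0 1 x) i) (count₂-ab x x0≡a x1≡b c) ⟨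
  count c x 2 + count c (Dat 0 1 x) i  ≡⟨ count-+ c x 2 i ⟨
  count c x (2 + i)                    ≡⟨ suc-injective #2+i ⟩
  suc n                                ∎)

nth-++ : ∀ l r i → i < length l → nth (l ++ r) i ≡ nth l i
nth-++ (y ∷ l) r zero _ = refl
nth-++ (y ∷ l) r (suc i) (s≤s i<|l|) = nth-++ l r i i<|l|

length-ρF* : ∀ l → length l ≤ length (ρF* l)
length-ρF* [] = z≤n
length-ρF* (a ∷ l) = s≤s (≤-trans (length-ρF* l) (n≤1+n _))
length-ρF* (b ∷ l) = s≤s (length-ρF* l)

nth-ρF* : ∀ l k j → k < length l → j < length (ρF (nth l k)) →
          nth (ρF* l) (k + count a (nth l) k + j) ≡ nth (ρF (nth l k)) j
nth-ρF* (y ∷ l) zero j _ j<|ρy| = nth-++ (ρF y) (ρF* l) j j<|ρy|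
nth-ρF* (a ∷ l) (suc k) j (s≤s k<|l|) j<|ρy| = begin
  nth (ρF* (a ∷ l)) (suc k + count a (nth (a ∷ l)) (suc k) + j)
    ≡⟨ cong (λ m → nth (ρF* (a ∷ l)) (suc k + m + j)) (count-+ a (nth (a ∷ l)) 1 k) ⟩
  nth (b ∷ ρF* l) (k + suc (count a (nth l) k) + j)
    ≡⟨ cong (λ m → nth (b ∷ ρF* l) (m + j)) (+-suc k _) ⟩
  nth (ρF* l) (k + count a (nth l) k + j)
    ≡⟨ nth-ρF* l k j k<|l| j<|ρy| ⟩
  nth (ρF (nth l k)) j
    ∎
nth-ρF* (b ∷ l) (suc k) j (s≤s k<|l|) j<|ρy| =
  trans (cong (λ m → nth (ρF* (b ∷ l)) (suc k + m + j)) (count-+ a (nth (b ∷ l)) 1 k))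
        (nth-ρF* l k j k<|l| j<|ρy|)

iterρ-head : ∀ k → ∃ λ t → iterρ k ≡ a ∷ t
iterρ-head zero = [] , refl
iterρ-head (suc k) with iterρ-head k
... | t , e = b ∷ ρF* t , cong ρF* e

length-iterρ : ∀ k → k < length (iterρ k)
length-iterρ zero = s≤s z≤n
length-iterρ (suc k) with iterρ k | length-iterρ k | iterρ-head k
... | _ | s≤s k≤|t| | t , refl = s≤s (s≤s (≤-trans k≤|t| (length-ρF* t)))

iterρ-prefix : k ≤ q → ∃ λ r → iterρ q ≡ iterρ k ++ r
iterρ-prefix {q = q} z≤n = iterρ-head q
iterρ-prefix {suc k} (s≤s k≤q) with iterρ-prefix k≤q
... | r , e = ρF* r , trans (cong ρF* e) (concatMap-++ ρF (iterρ k) r)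

nth-iterρ-mono : ∀ {k q} i → k ≤ q → i < length (iterρ k) → nth (iterρ q) i ≡ nth (iterρ k) i
nth-iterρ-mono {k} i k≤q i<|ρᵏ| with iterρ-prefix k≤q
... | r , e = trans (cong (λ l → nth l i) e) (nth-++ (iterρ k) r i i<|ρᵏ|)

fib-nth-iterρ : ∀ k i → i < length (iterρ k) → fib i ≡ nth (iterρ k) i
fib-nth-iterρ k i i<|ρᵏ| with ≤-total (suc i) k
... | inj₁ 1+i≤k = sym (nth-iterρ-mono i 1+i≤k (≤-trans (n≤1+n _) (length-iterρ (suc i))))
... | inj₂ k≤1+i = nth-iterρ-mono i k≤1+i i<|ρᵏ|

imagePos : ℕ → ℕ
imagePos k = k + count a fib k

fib-image : ∀ k j → j < length (ρF (fib k)) → fib (imagePos k + j) ≡ nth (ρF (fib k)) j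
fib-image k j j<|ρfₖ| = begin
  fib (imagePos k + j)                 ≡⟨ fib-nth-iterρ (suc K) K (≤-trans K<|X| (length-ρF* X)) ⟩
  nth (ρF* X) (imagePos k + j)         ≡⟨ cong (λ m → nth (ρF* X) (k + m + j)) (count-ext a k fib≗X) ⟩
  nth (ρF* X) (k + count a (nth X) k + j)
    ≡⟨ nth-ρF* X k j k<|X| (subst (λ y → j < length (ρF y)) fₖ≡Xₖ j<|ρfₖ|) ⟩
  nth (ρF (nth X k)) j                 ≡⟨ cong (λ y → nth (ρF y) j) fₖ≡Xₖ ⟨
  nth (ρF (fib k)) j                   ∎
  where
  K = imagePos k + j
  X = iterρ K
  K<|X| : K < length X
  K<|X| = length-iterρ K
  k<|X| : k < length X
  k<|X| = ≤-trans (s≤s (≤-trans (m≤m+n k _) (m≤m+n _ j))) K<|X|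
  fₖ≡Xₖ : fib k ≡ nth X k
  fₖ≡Xₖ = fib-nth-iterρ K k k<|X|
  fib≗X : ∀ i → i < k → fib i ≡ nth X i
  fib≗X i i<k = fib-nth-iterρ K i (≤-trans i<k (≤-trans (n≤1+n k) k<|X|))

fib-image-a : ∀ k → fib (imagePos k) ≡ a
fib-image-a k with fib k | fib-image k 0
... | a | image = trans (cong fib (sym (+-identityʳ (imagePos k)))) (image (s≤s z≤n))
... | b | image = trans (cong fib (sym (+-identityʳ (imagePos k)))) (image (s≤s z≤n))

fib-image-b : ∀ k → fib k ≡ a → fib (suc (imagePos k)) ≡ b
fib-image-b k fₖ≡a = begin
  fib (suc (imagePos k))   ≡⟨ cong fib (+-comm 1 (imagePos k)) ⟩
  fib (imagePos k + 1)     ≡⟨ fib-image k 1 (subst (λ y → 1 < length (ρF y)) (sym fₖ≡a) ≤-refl) ⟩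
  nth (ρF (fib k)) 1       ≡⟨ cong (λ y → nth (ρF y) 1) fₖ≡a ⟩
  b                        ∎

count-a-imagePos : ∀ k → count a fib (imagePos k) ≡ k
count-a-imagePos zero = refl
count-a-imagePos (suc k) = step (fib k) refl
  where
  step : ∀ y → fib k ≡ y → count a fib (imagePos (suc k)) ≡ suc k
  step a fₖ≡a = begin
    count a fib (suc k + count a fib (suc k))    ≡⟨ cong (λ m → count a fib (suc k + m)) (count-hit fib k fₖ≡a) ⟩
    count a fib (suc (k + suc (count a fib k)))  ≡⟨ cong (count a fib ∘′ suc) (+-suc k _) ⟩
    count a fib (suc (suc (imagePos k)))         ≡⟨ count-miss fib (suc (imagePos k)) (fib-image-b k fₖ≡a) (λ ()) ⟩
    count a fib (suc (imagePos k))               ≡⟨ count-hit fib (imagePos k) (fib-image-a k) ⟩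
    suc (count a fib (imagePos k))               ≡⟨ cong suc (count-a-imagePos k) ⟩
    suc k                                        ∎
  step b fₖ≡b = begin
    count a fib (suc k + count a fib (suc k))    ≡⟨ cong (λ m → count a fib (suc k + m)) (count-miss fib k fₖ≡b (λ ())) ⟩
    count a fib (suc (imagePos k))               ≡⟨ count-hit fib (imagePos k) (fib-image-a k) ⟩
    suc (count a fib (imagePos k))               ≡⟨ cong suc (count-a-imagePos k) ⟩
    suc k                                        ∎

count-b-imagePos : ∀ k → count b fib (imagePos k) ≡ count a fib k
count-b-imagePos k = +-cancelˡ-≡ k _ _ (begin
  k + count b fib (imagePos k)                        ≡⟨ cong (_+ count b fib (imagePos k)) (count-a-imagePos k) ⟨
  count a fib (imagePos k) + count b fib (imagePos k) ≡⟨ count-a+count-b fib (imagePos k) ⟩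
  imagePos k                                          ∎)

fib-first-a : IsNth fib a 1 0
fib-first-a = refl , refl

fib-first-b : IsNth fib b 1 1
fib-first-b = refl , refl

fib-nth-a : ∀ n → IsNth fib a (suc n) (imagePos n)
fib-nth-a n = fib-image-a n , cong suc (count-a-imagePos n)

fib-nth-b : ∀ n → IsNth fib b (suc n) (imagePos n + suc n)
fib-nth-b n = subst (IsNth fib b (suc n)) position
  (fib-image-b m (fib-image-a n) , cong suc (begin
    count b fib (suc (imagePos m))  ≡⟨ count-miss fib (imagePos m) (fib-image-a m) (λ ()) ⟩
    count b fib (imagePos m)        ≡⟨ count-b-imagePos m ⟩
    count a fib m                   ≡⟨ count-a-imagePos n ⟩
    n                               ∎))
  where
  m = imagePos n
  position : suc (imagePos m) ≡ m + suc n
  position = trans (cong (λ k → suc (m + k)) (count-a-imagePos n)) (sym (+-suc m n))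

theorem4p7 : (pa pb : ℕ) → IsNth fib a 1 pa → IsNth fib b 1 pb →
    (n : ℕ) → n ≥ 1 →
      Σ ℕ (λ i → Σ ℕ (λ j →
        IsNth (Dat pa pb fib) a n i × IsNth (Dat pa pb fib) b n j × j ≡ i + suc n))
theorem4p7 pa pb first-a first-b (suc n) _
  with IsNth-unique pa 0 first-a fib-first-a | IsNth-unique pb 1 first-b fib-first-b
... | refl | refl
  with IsNth-Dat01 fib (imagePos (suc n)) refl refl (fib-nth-a (suc n))
     | IsNth-Dat01 fib (imagePos (suc n) + suc (suc n)) refl refl (fib-nth-b (suc n))
... | i , pos-a≡2+i , nth-a | j , pos-b≡2+j , nth-b =
  i , j , nth-a , nth-b , +-cancelˡ-≡ 2 _ _ (trans (sym pos-b≡2+j) (cong (_+ suc (suc n)) pos-a≡2+i))
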